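{- Let $\mathbb{F}$ be a field and let $A\in\mathbb{F}^{m\times k}$ be a row-balanced matrix of rank $m$. Let $x=(x_1,\ldots,x_k)$, $x_j\in\mathbb{F}^n$, be a solution of $Ax^\mathsf{T}=0$ with $\operatorname{arank}(x)=k-m$. Let $U\subseteq[k]$ have size $m$. Then $U$ is a basis of $A$ if and only if $\operatorname{arank}\{x_i:i\in[k]\setminus U\}=k-m$.
   Context: Row-balanced: each row of $A$ sums to $0$. $Ax^\mathsf{T}=0$ means $\sum_j a_{ij}x_j=0$ for all $i$. The affine rank $\operatorname{arank}$ of a collection of vectors is the maximum number of affinely independent vectors among them (equivalently the rank of the matrix with columns $\binom{1}{x_j}$). $U\subseteq[k]$ is a \emph{basis} of $A$ if the columns of $A$ indexed by $U$ are linearly independent and $|U|=\operatorname{rank}(A)$. -}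

module Defs where

open import Level using (Level; _⊔_) renaming (suc to lsuc)
open import Data.Nat using (ℕ; zero; suc; _≤_)
import Data.Fin.Subset
open import Data.Fin using (Fin)
import Data.Fin as Fin
open import Data.Fin.Subset using (Subset; _∈_; _∉_; _⊆_; ∣_∣)
open import Data.Product using (Σ; ∃; _×_; _,_)
open import Relation.Nullary using (¬_)
open import Relation.Binary.PropositionalEquality using (_≡_)
open import Algebra.Bundles using (CommutativeRing)

record Field (c ℓ : Level) : Set (lsuc (c ⊔ ℓ)) where
  field
    commutativeRing : CommutativeRing c ℓ
  open CommutativeRing commutativeRing public
  field
    1≉0 : ¬ (1# ≈ 0#)
    inverse : ∀ x → ¬ (x ≈ 0#) → ∃ λ y → (x * y) ≈ 1#

module FieldDefs {c ℓ : Level} (F : Field c ℓ) where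
  open Field F

  sumF : ∀ {k} → (Fin k → Carrier) → Carrier
  sumF {zero}  f = 0#
  sumF {suc k} f = f Fin.zero + sumF (λ j → f (Fin.suc j))

  Matrix : ℕ → ℕ → Set c
  Matrix m k = Fin m → Fin k → Carrier

  RowBalanced : ∀ {m k} → Matrix m k → Set ℓ
  RowBalanced A = ∀ i → sumF (A i) ≈ 0#

  -- x = (x_1,…,x_k), x_j ∈ F^n  (x j t is the t-th coordinate of x_j)
  -- A xᵀ = 0 :  Σ_j a_ij x_j = 0  for all i
  IsSolution : ∀ {m k n} → Matrix m k → (Fin k → Fin n → Carrier) → Set ℓ
  IsSolution A x = ∀ i t → sumF (λ j → A i j * x j t) ≈ 0#

  LinIndepOn : ∀ {k d} → (Fin k → Fin d → Carrier) → Subset k → Set (c ⊔ ℓ)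
  LinIndepOn {k} v S = ∀ (a : Fin k → Carrier) → (∀ j → j ∉ S → a j ≈ 0#) →
    (∀ t → sumF (λ j → a j * v j t) ≈ 0#) → ∀ j → j ∈ S → a j ≈ 0#

  AffIndepOn : ∀ {k d} → (Fin k → Fin d → Carrier) → Subset k → Set (c ⊔ ℓ)
  AffIndepOn {k} v S = ∀ (a : Fin k → Carrier) → (∀ j → j ∉ S → a j ≈ 0#) →
    sumF a ≈ 0# → (∀ t → sumF (λ j → a j * v j t) ≈ 0#) → ∀ j → j ∈ S → a j ≈ 0#

  MaxSizeWithin : ∀ {k} → (Subset k → Set (c ⊔ ℓ)) → Subset k → ℕ → Set (c ⊔ ℓ)
  MaxSizeWithin {k} Indep T r =
    (Σ (Subset k) λ S → S ⊆ T × Indep S × ∣ S ∣ ≡ r) ×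
    (∀ (S : Subset k) → S ⊆ T → Indep S → ∣ S ∣ ≤ r)

  col : ∀ {m k} → Matrix m k → Fin k → Fin m → Carrier
  col A j i = A i j

  HasRank : ∀ {m k} → Matrix m k → ℕ → Set (c ⊔ ℓ)
  HasRank {m} {k} A r = MaxSizeWithin (LinIndepOn (col A)) (Data.Fin.Subset.⊤) r

  ARankOn : ∀ {k n} → (Fin k → Fin n → Carrier) → Subset k → ℕ → Set (c ⊔ ℓ)
  ARankOn x T r = MaxSizeWithin (AffIndepOn x) T r

  IsBasis : ∀ {m k} → Matrix m k → Subset k → Set (c ⊔ ℓ)
  IsBasis A U = LinIndepOn (col A) U × HasRank A ∣ U ∣

{-# OPTIONS --safe #-}
module Submission where

-- Call a ∈ 𝔽ᵏ an affine dependency of x if Σⱼ aⱼ = 0 and Σⱼ aⱼ xⱼ = 0. Every row combination Aᵀy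
-- is one, because A is row-balanced and Axᵀ = 0. Conversely, if x is affinely independent on a set
-- S with |∁ S| = m, a dependency is determined by its entries off S, and some Aᵀy matches those
-- entries since the m columns of A outside S are independent; so the affine dependencies are exactly
-- the row combinations. Hence {xᵢ : i ∉ U} is affinely independent iff no nonzero Aᵀy vanishes on U,
-- i.e. iff the square submatrix A_U has independent rows, i.e. independent columns.
-- The facts about square matrices come from determinants: a trivial kernel forces det ≠ 0 by
-- Gaussian elimination (choosing a pivot classically is harmless, the goal being a negation), and
-- the cofactors then give an explicit inverse.

open import Level using (Level; _⊔_)
open import Data.Nat as ℕ using (ℕ; zero; suc; _≤_; _∸_)
open import Data.Fin using (Fin; zero; suc; punchIn; lift)
open import Data.Product using (∃; _×_; _,_; proj₁; proj₂)
open import Function using (_∘_; const; id)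
open import Data.Empty using (⊥-elim)
open import Relation.Nullary using (¬_; yes; no)
open import Relation.Binary.PropositionalEquality as ≡ using (_≡_; _≢_; _≗_)
open import Data.Fin.Subset using (Subset; _∈_; _∉_; _⊆_; ∣_∣; ∁; ⊤; inside; outside)
open import Data.Fin.Subset.Properties
  using (_∈?_; p⊂q⇒∣p∣<∣q∣; p⊆q⇒∣p∣≤∣q∣; drop-there; x∉∁p⇒x∈p; x∉p⇒x∈∁p; x∈∁p⇒x∉p; x∈p⇒x∉∁p;
         ∣∁p∣≡n∸∣p∣; ∣p∣≤n)
open import Data.Vec.Base using ([]; _∷_; here; there)
open import Data.Nat.Properties using (<⇒≱; ≤-reflexive; m∸[m∸n]≡n)
open import Function.Bundles using (_⇔_; mk⇔)
open import Defs

¬¬-∀ : ∀ {p n} {P : Fin n → Set p} → (∀ i → ¬ ¬ P i) → ¬ ¬ (∀ i → P i)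
¬¬-∀ {n = zero}  _   k = k λ ()
¬¬-∀ {n = suc n} ¬¬P k = ¬¬P zero λ P₀ → ¬¬-∀ (¬¬P ∘ suc) λ P₊ → k λ where
  zero    → P₀
  (suc i) → P₊ i

p⊆q⇒∣q∣≤∣p∣⇒q⊆p : ∀ {k} {p q : Subset k} → p ⊆ q → ∣ q ∣ ≤ ∣ p ∣ → q ⊆ p
p⊆q⇒∣q∣≤∣p∣⇒q⊆p {p = p} {q} p⊆q ∣q∣≤∣p∣ {j} j∈q with j ∈? p
... | yes j∈p = j∈p
... | no  j∉p = ⊥-elim (<⇒≱ (p⊂q⇒∣p∣<∣q∣ (p⊆q , j , j∈q , j∉p)) ∣q∣≤∣p∣)

module Vectors {c ℓ : Level} (F : Field c ℓ) where
  open Field F hiding (zero)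
  open FieldDefs F
  open import Algebra.Properties.Ring ring using (-‿+-comm; -0#≈0#; [y-z]x≈yx-zx)
  open import Algebra.Properties.Semiring.Sum semiring
    using (sum; sum-cong-≋; sum-replicate-zero; ∑-distrib-+; ∑-comm; *-distribˡ-sum)
  open import Algebra.Solver.Ring.NaturalCoefficients.Default commutativeSemiring
    using (solve; _:=_; _:*_)
  open import Relation.Binary.Reasoning.Setoid setoid

  infix 7 _·_
  infixr 6 _*ᵥ_
  infix 8 _ᵀ

  _·_ : ∀ {n} → (Fin n → Carrier) → (Fin n → Carrier) → Carrier
  u · v = sumF (λ j → u j * v j)

  _*ᵥ_ : ∀ {m k} → Matrix m k → (Fin k → Carrier) → Fin m → Carrier
  (M *ᵥ w) i = M i · w

  _ᵀ : ∀ {m k} → Matrix m k → Matrix k m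
  M ᵀ = col M

  sumF≈sum : ∀ {n} (f : Fin n → Carrier) → sumF f ≈ sum f
  sumF≈sum {zero}  f = refl
  sumF≈sum {suc n} f = +-congˡ (sumF≈sum (f ∘ suc))

  sumF-cong : ∀ {n} {f g : Fin n → Carrier} → (∀ j → f j ≈ g j) → sumF f ≈ sumF g
  sumF-cong {f = f} {g} f≈g = begin
    sumF f ≈⟨ sumF≈sum f ⟩
    sum f  ≈⟨ sum-cong-≋ f≈g ⟩
    sum g  ≈⟨ sumF≈sum g ⟨
    sumF g ∎

  sumF-zero : ∀ {n} {f : Fin n → Carrier} → (∀ j → f j ≈ 0#) → sumF f ≈ 0#
  sumF-zero {n} f≈0 = trans (sumF-cong f≈0) (trans (sumF≈sum {n} (λ _ → 0#)) (sum-replicate-zero n))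

  sumF-+ : ∀ {n} (f g : Fin n → Carrier) → sumF (λ j → f j + g j) ≈ sumF f + sumF g
  sumF-+ f g = begin
    sumF (λ j → f j + g j) ≈⟨ sumF≈sum (λ j → f j + g j) ⟩
    sum (λ j → f j + g j)  ≈⟨ ∑-distrib-+ f g ⟩
    sum f + sum g          ≈⟨ +-cong (sumF≈sum f) (sumF≈sum g) ⟨
    sumF f + sumF g        ∎

  *-distribˡ-sumF : ∀ {n} a (f : Fin n → Carrier) → a * sumF f ≈ sumF (λ j → a * f j)
  *-distribˡ-sumF a f = begin
    a * sumF f             ≈⟨ *-congˡ (sumF≈sum f) ⟩
    a * sum f              ≈⟨ *-distribˡ-sum a f ⟩
    sum (λ j → a * f j)    ≈⟨ sumF≈sum (λ j → a * f j) ⟨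
    sumF (λ j → a * f j)   ∎

  sumF-comm : ∀ {m n} (f : Fin m → Fin n → Carrier) →
    sumF (λ i → sumF (f i)) ≈ sumF (λ j → sumF (λ i → f i j))
  sumF-comm f = begin
    sumF (λ i → sumF (f i))              ≈⟨ sumF-cong (λ i → sumF≈sum (f i)) ⟩
    sumF (λ i → sum (f i))               ≈⟨ sumF≈sum (λ i → sum (f i)) ⟩
    sum (λ i → sum (f i))                ≈⟨ ∑-comm f ⟩
    sum (λ j → sum (λ i → f i j))        ≈⟨ sumF≈sum (λ j → sum (λ i → f i j)) ⟨
    sumF (λ j → sum (λ i → f i j))       ≈⟨ sumF-cong (λ j → sumF≈sum (λ i → f i j)) ⟨
    sumF (λ j → sumF (λ i → f i j))      ∎

  sumF-neg : ∀ {n} (f : Fin n → Carrier) → sumF (λ j → - f j) ≈ - sumF f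
  sumF-neg {zero}  f = sym -0#≈0#
  sumF-neg {suc n} f = trans (+-congˡ (sumF-neg (f ∘ suc))) (-‿+-comm (f zero) _)

  sumF-linear : ∀ {n} {u f g : Fin n → Carrier} a → (∀ j → u j ≈ f j + a * g j) →
    sumF u ≈ sumF f + a * sumF g
  sumF-linear {u = u} {f} {g} a u≈ = begin
    sumF u                                 ≈⟨ sumF-cong u≈ ⟩
    sumF (λ j → f j + a * g j)             ≈⟨ sumF-+ f (λ j → a * g j) ⟩
    sumF f + sumF (λ j → a * g j)          ≈⟨ +-congˡ (*-distribˡ-sumF a g) ⟨
    sumF f + a * sumF g                    ∎

  sumF-− : ∀ {n} (f g : Fin n → Carrier) → sumF (λ j → f j - g j) ≈ sumF f - sumF g
  sumF-− f g = trans (sumF-+ f (λ j → - g j)) (+-congˡ (sumF-neg g))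

  ·-comm : ∀ {n} (u v : Fin n → Carrier) → u · v ≈ v · u
  ·-comm u v = sumF-cong (λ j → *-comm (u j) (v j))

  ·-−ˡ : ∀ {n} (u v w : Fin n → Carrier) → (λ j → u j - v j) · w ≈ u · w - v · w
  ·-−ˡ u v w = trans (sumF-cong (λ j → [y-z]x≈yx-zx (w j) (u j) (v j)))
                     (sumF-− (λ j → u j * w j) (λ j → v j * w j))

  ·-1ʳ : ∀ {n} (u : Fin n → Carrier) → u · (λ _ → 1#) ≈ sumF u
  ·-1ʳ u = sumF-cong (λ j → *-identityʳ (u j))

  ·-zeroʳ : ∀ {n} (u : Fin n → Carrier) {v : Fin n → Carrier} → (∀ j → v j ≈ 0#) → u · v ≈ 0#
  ·-zeroʳ u v≈0 = sumF-zero (λ j → trans (*-congˡ (v≈0 j)) (zeroʳ (u j)))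

  ᵀ-adjoint : ∀ {m k} (M : Matrix m k) (y : Fin m → Carrier) (w : Fin k → Carrier) →
    (M ᵀ *ᵥ y) · w ≈ y · (M *ᵥ w)
  ᵀ-adjoint M y w = begin
    sumF (λ j → sumF (λ i → M i j * y i) * w j)     ≈⟨ sumF-cong (λ j → trans (*-comm _ (w j))
                                                         (*-distribˡ-sumF (w j) (λ i → M i j * y i))) ⟩
    sumF (λ j → sumF (λ i → w j * (M i j * y i)))   ≈⟨ sumF-comm (λ i j → w j * (M i j * y i)) ⟨
    sumF (λ i → sumF (λ j → w j * (M i j * y i)))   ≈⟨ sumF-cong (λ i → sumF-cong (λ j → rearrange (w j) (M i j) (y i))) ⟩
    sumF (λ i → sumF (λ j → y i * (M i j * w j)))   ≈⟨ sumF-cong (λ i → *-distribˡ-sumF (y i) (λ j → M i j * w j)) ⟨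
    sumF (λ i → y i * sumF (λ j → M i j * w j))     ∎
    where
    rearrange : ∀ u v w → u * (v * w) ≈ w * (v * u)
    rearrange = solve 3 (λ u v w → u :* (v :* w) := w :* (v :* u)) refl

  δ : ∀ {n} → Fin n → Fin n → Carrier
  δ zero    zero    = 1#
  δ zero    (suc j) = 0#
  δ (suc i) zero    = 0#
  δ (suc i) (suc j) = δ i j

  δ-refl : ∀ {n} (i : Fin n) → δ i i ≡ 1#
  δ-refl zero    = ≡.refl
  δ-refl (suc i) = δ-refl i

  δ-≢ : ∀ {n} {i j : Fin n} → i ≢ j → δ i j ≡ 0#
  δ-≢ {i = zero}  {zero}  0≢0 = ⊥-elim (0≢0 ≡.refl)
  δ-≢ {i = zero}  {suc j} _   = ≡.refl
  δ-≢ {i = suc i} {zero}  _   = ≡.refl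
  δ-≢ {i = suc i} {suc j} i≢j = δ-≢ (i≢j ∘ ≡.cong suc)

  δ-sym : ∀ {n} (i j : Fin n) → δ i j ≡ δ j i
  δ-sym zero    zero    = ≡.refl
  δ-sym zero    (suc j) = ≡.refl
  δ-sym (suc i) zero    = ≡.refl
  δ-sym (suc i) (suc j) = δ-sym i j

  ·-δ : ∀ {n} (b : Fin n → Carrier) i → b · δ i ≈ b i
  ·-δ {suc n} b zero = begin
    b zero * 1# + (b ∘ suc) · (λ _ → 0#) ≈⟨ +-cong (*-identityʳ _) (·-zeroʳ (b ∘ suc) (λ _ → refl)) ⟩
    b zero + 0#                          ≈⟨ +-identityʳ _ ⟩
    b zero                               ∎
  ·-δ {suc n} b (suc i) = begin
    b zero * 0# + (b ∘ suc) · δ i        ≈⟨ +-cong (zeroʳ _) (·-δ (b ∘ suc) i) ⟩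
    0# + b (suc i)                       ≈⟨ +-identityˡ _ ⟩
    b (suc i)                            ∎

module Determinants {c ℓ : Level} (F : Field c ℓ) where
  open Field F hiding (zero)
  open FieldDefs F
  open Vectors F
  open import Algebra.Properties.Ring ring using (-‿distribˡ-*; -‿distribʳ-*; -‿involutive; +-inverseˡ-unique; -0#≈0#)
  open import Algebra.Solver.Ring.NaturalCoefficients.Default commutativeSemiring
    using (solve; _:=_; _:+_; _:*_)
  open import Data.Vec.Functional using (updateAt)
  open import Data.Vec.Functional.Properties
    using (updateAt-updates; updateAt-minimal; updateAt-id-local; updateAt-commutes; map-updateAt)
  open import Relation.Binary.Reasoning.Setoid setoid

  sgn : ∀ {n} → Fin n → Carrier
  sgn zero    = 1#
  sgn (suc j) = - sgn j

  minor : ∀ {n} → Fin (suc n) → Matrix (suc n) (suc n) → Matrix n n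
  minor j M i t = M (suc i) (punchIn j t)

  det : ∀ {n} → Matrix n n → Carrier
  cofactor : ∀ {n} → Matrix (suc n) (suc n) → Fin (suc n) → Carrier

  det {zero}  M = 1#
  det {suc n} M = M zero · cofactor M

  cofactor M j = sgn j * det (minor j M)

  det-cong : ∀ {n} {M N : Matrix n n} → (∀ i t → M i t ≈ N i t) → det M ≈ det N
  det-cong {zero}  M≈N = refl
  det-cong {suc n} M≈N = sumF-cong λ j →
    *-cong (M≈N zero j) (*-congˡ {sgn j} (det-cong (λ i t → M≈N (suc i) (punchIn j t))))

  det-≗ : ∀ {n} {M N : Matrix n n} → M ≗ N → det M ≈ det N
  det-≗ M≗N = det-cong (λ i t → reflexive (≡.cong-app (M≗N i) t))

  infixl 9 _[_]≔_

  _[_]≔_ : ∀ {n k} → Matrix n k → Fin n → (Fin k → Carrier) → Matrix n k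
  M [ s ]≔ r = updateAt M s (const r)

  []≔-columns : ∀ {n k k′} (M : Matrix n k) s r (h : Fin k′ → Fin k) i →
    (M [ s ]≔ r) i ∘ h ≡ ((λ l → M l ∘ h) [ s ]≔ (r ∘ h)) i
  []≔-columns M s r h = map-updateAt {f = _∘ h} (λ _ → ≡.refl) M s

  minor-[]≔ : ∀ {n} (M : Matrix (suc n) (suc n)) j s r i →
    minor j (M [ suc s ]≔ r) i ≡ (minor j M [ s ]≔ (r ∘ punchIn j)) i
  minor-[]≔ M j s r = []≔-columns (M ∘ suc) s r (punchIn j)

  det-linear : ∀ {n} (M : Matrix n n) s {u x y : Fin n → Carrier} a →
    (∀ t → u t ≈ x t + a * y t) →
    det (M [ s ]≔ u) ≈ det (M [ s ]≔ x) + a * det (M [ s ]≔ y)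
  det-linear {suc n} M zero {x = x} {y} a u≈ = sumF-linear a λ j →
    trans (*-congʳ (u≈ j)) (trans (distribʳ (cofactor M j) (x j) (a * y j)) (+-congˡ (*-assoc a (y j) (cofactor M j))))
  det-linear {suc n} M (suc s) {u} {x} {y} a u≈ = sumF-linear a λ j → begin
      M zero j * cofactor (M [ suc s ]≔ u) j
    ≈⟨ *-congˡ (*-congˡ (minor-det u j)) ⟩
      M zero j * (sgn j * det (minor j M [ s ]≔ (u ∘ punchIn j)))
    ≈⟨ *-congˡ (*-congˡ (det-linear (minor j M) s a (u≈ ∘ punchIn j))) ⟩
      M zero j * (sgn j * (det (minor j M [ s ]≔ (x ∘ punchIn j)) + a * det (minor j M [ s ]≔ (y ∘ punchIn j))))
    ≈⟨ solve 5 (λ m g a p q → m :* (g :* (p :+ a :* q)) := m :* (g :* p) :+ a :* (m :* (g :* q)))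
         refl (M zero j) (sgn j) a _ _ ⟩
      M zero j * (sgn j * det (minor j M [ s ]≔ (x ∘ punchIn j)))
        + a * (M zero j * (sgn j * det (minor j M [ s ]≔ (y ∘ punchIn j))))
    ≈⟨ +-cong (*-congˡ (*-congˡ (minor-det x j))) (*-congˡ (*-congˡ (*-congˡ (minor-det y j)))) ⟨
      M zero j * cofactor (M [ suc s ]≔ x) j + a * (M zero j * cofactor (M [ suc s ]≔ y) j)
    ∎
    where
    minor-det : ∀ r j → det (minor j (M [ suc s ]≔ r)) ≈ det (minor j M [ s ]≔ (r ∘ punchIn j))
    minor-det r j = det-≗ (minor-[]≔ M j s r)

  det-additive : ∀ {n} (M : Matrix n n) s (x y : Fin n → Carrier) →
    det (M [ s ]≔ (λ t → x t + y t)) ≈ det (M [ s ]≔ x) + det (M [ s ]≔ y)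
  det-additive M s x y = trans (det-linear M s 1# (λ t → +-congˡ (sym (*-identityˡ (y t)))))
                                (+-congˡ (*-identityˡ _))

  Alternating : ℕ → Set (c ⊔ ℓ)
  Alternating n = ∀ (M : Matrix n n) {r s} → r ≢ s → (∀ t → M r t ≈ M s t) → det M ≈ 0#

  swapRows : ∀ {n k} → Matrix n k → Fin n → Fin n → Matrix n k
  swapRows M r s = (M [ r ]≔ M s) [ s ]≔ M r

  det-swapRows : ∀ {n} → Alternating n → ∀ (M : Matrix n n) {r s} → r ≢ s →
    det (swapRows M r s) ≈ - det M
  det-swapRows {n} alt M {r} {s} r≢s = +-inverseˡ-unique _ _ (begin
      D Y X + det M                      ≈⟨ +-cong (+-identityʳ _) (+-identityˡ _) ⟨
      (D Y X + 0#) + (0# + det M)        ≈⟨ +-cong (+-congˡ (D-diag Y)) (+-cong (D-diag X) D-XY) ⟨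
      (D Y X + D Y Y) + (D X X + D X Y)  ≈⟨ +-comm _ _ ⟩
      (D X X + D X Y) + (D Y X + D Y Y)  ≈⟨ +-cong (D-additiveʳ X) (D-additiveʳ Y) ⟨
      D X Z + D Y Z                      ≈⟨ D-additiveˡ Z ⟨
      D Z Z                              ≈⟨ D-diag Z ⟩
      0#                                 ∎)
    where
    X Y Z : Fin n → Carrier
    X = M r
    Y = M s
    Z t = X t + Y t

    D : (u v : Fin n → Carrier) → Carrier
    D u v = det ((M [ r ]≔ u) [ s ]≔ v)

    D-diag : ∀ u → D u u ≈ 0#
    D-diag u = alt ((M [ r ]≔ u) [ s ]≔ u) r≢s λ t → reflexive (≡.cong-app (≡.trans
      (≡.trans (updateAt-minimal r s (M [ r ]≔ u) r≢s) (updateAt-updates r M))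
      (≡.sym (updateAt-updates s (M [ r ]≔ u)))) t)

    D-XY : D X Y ≈ det M
    D-XY = det-≗ λ i → ≡.trans
      (updateAt-id-local s (M [ r ]≔ X) (≡.sym (updateAt-minimal s r M (r≢s ∘ ≡.sym))) i)
      (updateAt-id-local r M ≡.refl i)

    D-additiveʳ : ∀ u → D u Z ≈ D u X + D u Y
    D-additiveʳ u = det-additive (M [ r ]≔ u) s X Y

    D-swap : ∀ u v → D u v ≈ det ((M [ s ]≔ v) [ r ]≔ u)
    D-swap u v = det-≗ (updateAt-commutes s r (r≢s ∘ ≡.sym) M)

    D-additiveˡ : ∀ v → D Z v ≈ D X v + D Y v
    D-additiveˡ v = begin
      D Z v                                                    ≈⟨ D-swap Z v ⟩
      det ((M [ s ]≔ v) [ r ]≔ Z)                              ≈⟨ det-additive (M [ s ]≔ v) r X Y ⟩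
      det ((M [ s ]≔ v) [ r ]≔ X) + det ((M [ s ]≔ v) [ r ]≔ Y) ≈⟨ +-cong (D-swap X v) (D-swap Y v) ⟨
      D X v + D Y v                                            ∎

  -x*-y≈x*y : ∀ x y → - x * - y ≈ x * y
  -x*-y≈x*y x y = begin
    - x * - y     ≈⟨ -‿distribˡ-* x (- y) ⟨
    - (x * - y)   ≈⟨ -‿cong (-‿distribʳ-* x y) ⟨
    - - (x * y)   ≈⟨ -‿involutive _ ⟩
    x * y         ∎

  -- A term of the expansion of det along its first two rows when both equal a; G σ stands for the
  -- determinant of the remaining rows restricted to the columns σ.
  twoRowTerm : ∀ {m} (a : Fin (suc (suc m)) → Carrier) (G : (Fin m → Fin (suc (suc m))) → Carrier) →
    Fin (suc (suc m)) → Fin (suc m) → Carrier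
  twoRowTerm a G j j′ = sgn j * sgn j′ * (a j * a (punchIn j j′)) * G (punchIn j ∘ punchIn j′)

  -- The terms for the column pairs (0 , i + 1) and (i + 1 , 0) cancel; the rest is the same
  -- sum for the matrix with column 0 deleted.
  twoRowTerms-cancel : ∀ m (a : Fin (suc (suc m)) → Carrier) (G : (Fin m → Fin (suc (suc m))) → Carrier) →
    (∀ {σ τ} → σ ≗ τ → G σ ≈ G τ) → sumF (λ j → sumF (twoRowTerm a G j)) ≈ 0#
  innerTerms-cancel : ∀ m (a : Fin (suc (suc m)) → Carrier) (G : (Fin m → Fin (suc (suc m))) → Carrier) →
    (∀ {σ τ} → σ ≗ τ → G σ ≈ G τ) → sumF (λ i → sumF (twoRowTerm a G (suc i) ∘ suc)) ≈ 0#

  twoRowTerms-cancel m a G G-cong = begin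
      sumF (T zero) + sumF (λ i → T (suc i) zero + sumF (T (suc i) ∘ suc))
    ≈⟨ +-congˡ (sumF-+ (λ i → T (suc i) zero) (λ i → sumF (T (suc i) ∘ suc))) ⟩
      sumF (T zero) + (sumF (λ i → T (suc i) zero) + sumF (λ i → sumF (T (suc i) ∘ suc)))
    ≈⟨ +-assoc _ _ _ ⟨
      (sumF (T zero) + sumF (λ i → T (suc i) zero)) + sumF (λ i → sumF (T (suc i) ∘ suc))
    ≈⟨ +-cong (trans (sym (sumF-+ (T zero) (λ i → T (suc i) zero))) (sumF-zero pair-cancels))
              (innerTerms-cancel m a G G-cong) ⟩
      0# + 0#
    ≈⟨ +-identityʳ 0# ⟩
      0#
    ∎
    where
    T : Fin (suc (suc m)) → Fin (suc m) → Carrier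
    T = twoRowTerm a G
    pair-cancels : ∀ i → T zero i + T (suc i) zero ≈ 0#
    pair-cancels i = trans (+-congˡ (begin
          - sgn i * 1# * (a (suc i) * a zero) * g
        ≈⟨ solve 5 (λ ns u y x g → ns :* u :* (y :* x) :* g := ns :* (u :* (x :* y) :* g))
             refl (- sgn i) 1# (a (suc i)) (a zero) g ⟩
          - sgn i * (1# * (a zero * a (suc i)) * g)
        ≈⟨ -‿distribˡ-* _ _ ⟨
          - (sgn i * (1# * (a zero * a (suc i)) * g))
        ≈⟨ -‿cong (solve 5 (λ s u x y g → s :* (u :* (x :* y) :* g) := u :* s :* (x :* y) :* g)
                     refl (sgn i) 1# (a zero) (a (suc i)) g) ⟩
          - T zero i
        ∎))
      (-‿inverseʳ (T zero i))
      where
      g : Carrier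
      g = G (suc ∘ punchIn i)

  innerTerms-cancel zero    a G G-cong = sumF-zero {1} (λ _ → refl)
  innerTerms-cancel (suc m) a G G-cong = trans (sumF-cong λ i → sumF-cong λ i′ → shift i i′)
    (twoRowTerms-cancel m (a ∘ suc) (G ∘ lift 1) λ σ≗τ → G-cong (lift-cong σ≗τ))
    where
    lift-cong : ∀ {σ τ : Fin m → Fin (suc (suc m))} → σ ≗ τ → lift 1 σ ≗ lift 1 τ
    lift-cong σ≗τ zero    = ≡.refl
    lift-cong σ≗τ (suc t) = ≡.cong suc (σ≗τ t)
    shift : ∀ i i′ → twoRowTerm a G (suc i) (suc i′) ≈ twoRowTerm (a ∘ suc) (G ∘ lift 1) i i′
    shift i i′ = *-cong (*-congʳ (-x*-y≈x*y (sgn i) (sgn i′))) (G-cong λ { zero → ≡.refl ; (suc t) → ≡.refl })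

  det-equalFirstTwoRows : ∀ {m} (M : Matrix (suc (suc m)) (suc (suc m))) →
    (∀ t → M (suc zero) t ≈ M zero t) → det M ≈ 0#
  det-equalFirstTwoRows {m} M row₁≈row₀ =
    trans (sumF-cong expand) (twoRowTerms-cancel m (M zero) G G-cong)
    where
    G : (Fin m → Fin (suc (suc m))) → Carrier
    G σ = det (λ i t → M (suc (suc i)) (σ t))
    G-cong : ∀ {σ τ} → σ ≗ τ → G σ ≈ G τ
    G-cong σ≗τ = det-cong (λ i t → reflexive (≡.cong (M (suc (suc i))) (σ≗τ t)))
    expand : ∀ j → M zero j * cofactor M j ≈ sumF (twoRowTerm (M zero) G j)
    expand j = begin
        M zero j * (sgn j * sumF (λ j′ → M (suc zero) (punchIn j j′) * cofactor (minor j M) j′))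
      ≈⟨ *-congˡ (*-distribˡ-sumF (sgn j) (λ j′ → M (suc zero) (punchIn j j′) * cofactor (minor j M) j′)) ⟩
        M zero j * sumF (λ j′ → sgn j * (M (suc zero) (punchIn j j′) * cofactor (minor j M) j′))
      ≈⟨ *-distribˡ-sumF (M zero j) (λ j′ → sgn j * (M (suc zero) (punchIn j j′) * cofactor (minor j M) j′)) ⟩
        sumF (λ j′ → M zero j * (sgn j * (M (suc zero) (punchIn j j′) * cofactor (minor j M) j′)))
      ≈⟨ sumF-cong (λ j′ → trans (*-congˡ (*-congˡ (*-congʳ (row₁≈row₀ (punchIn j j′)))))
           (solve 5 (λ x s y s′ g → x :* (s :* (y :* (s′ :* g))) := s :* s′ :* (x :* y) :* g) refl
             (M zero j) (sgn j) (M zero (punchIn j j′)) (sgn j′) (G (punchIn j ∘ punchIn j′)))) ⟩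
        sumF (twoRowTerm (M zero) G j)
      ∎

  det-repeatedFirstRow : ∀ {n} → Alternating n → (M : Matrix (suc n) (suc n)) (s : Fin n) →
    (∀ t → M zero t ≈ M (suc s) t) → det M ≈ 0#
  det-repeatedFirstRow {suc n} alt M zero row₀≈ = det-equalFirstTwoRows M (sym ∘ row₀≈)
  det-repeatedFirstRow {suc (suc n)} alt M (suc s) row₀≈ = begin
      det M       ≈⟨ -‿involutive (det M) ⟨
      - - det M   ≈⟨ -‿cong det-M′ ⟨
      - det M′    ≈⟨ -‿cong (det-equalFirstTwoRows M′ (sym ∘ row₀≈)) ⟩
      - 0#        ≈⟨ -0#≈0# ⟩
      0#          ∎
    where
    M′ : Matrix (suc (suc (suc n))) (suc (suc (suc n)))
    M′ = swapRows M (suc zero) (suc (suc s))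

    minor-M′ : ∀ j i → minor j M′ i ≡ swapRows (minor j M) zero (suc s) i
    minor-M′ j zero    = ≡.refl
    minor-M′ j (suc i) = []≔-columns (λ i → M (suc (suc i))) s (M (suc zero)) (punchIn j) i

    det-M′ : det M′ ≈ - det M
    det-M′ = begin
        M zero · cofactor M′
      ≈⟨ sumF-cong (λ j → *-congˡ {M zero j} (*-congˡ {sgn j}
           (trans (det-≗ (minor-M′ j)) (det-swapRows alt (minor j M) {zero} {suc s} λ ())))) ⟩
        sumF (λ j → M zero j * (sgn j * - det (minor j M)))
      ≈⟨ sumF-cong (λ j → trans (-‿distribʳ-* (M zero j) (cofactor M j))
                                (*-congˡ (-‿distribʳ-* (sgn j) (det (minor j M))))) ⟨
        sumF (λ j → - (M zero j * cofactor M j))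
      ≈⟨ sumF-neg (λ j → M zero j * cofactor M j) ⟩
        - det M
      ∎

  det-alternating : ∀ n → Alternating n
  det-alternating (suc n) M {zero}  {zero}  0≢0 _ = ⊥-elim (0≢0 ≡.refl)
  det-alternating (suc n) M {suc r} {suc s} r≢s rows≈ = sumF-zero λ j →
    trans (*-congˡ (*-congˡ {sgn j} (det-alternating n (minor j M) (r≢s ∘ ≡.cong suc) (rows≈ ∘ punchIn j))))
          (trans (*-congˡ (zeroʳ (sgn j))) (zeroʳ (M zero j)))
  det-alternating (suc n) M {zero}  {suc s} _ rows≈ = det-repeatedFirstRow (det-alternating n) M s rows≈
  det-alternating (suc n) M {suc r} {zero}  _ rows≈ = det-repeatedFirstRow (det-alternating n) M r (sym ∘ rows≈)

  det-addRow : ∀ {n} (M : Matrix n n) {r s} a → r ≢ s →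
    det (M [ s ]≔ (λ t → M s t + a * M r t)) ≈ det M
  det-addRow {n} M {r} {s} a r≢s = begin
      det (M [ s ]≔ (λ t → M s t + a * M r t))       ≈⟨ det-linear M s a (λ _ → refl) ⟩
      det (M [ s ]≔ M s) + a * det (M [ s ]≔ M r)   ≈⟨ +-cong (det-≗ (updateAt-id-local s M ≡.refl))
                                                              (*-congˡ (det-alternating n (M [ s ]≔ M r) r≢s repeated)) ⟩
      det M + a * 0#                                ≈⟨ +-congˡ (zeroʳ a) ⟩
      det M + 0#                                    ≈⟨ +-identityʳ _ ⟩
      det M                                         ∎
    where
    repeated : ∀ t → (M [ s ]≔ M r) r t ≈ (M [ s ]≔ M r) s t
    repeated t = reflexive (≡.cong-app (≡.trans (updateAt-minimal r s M r≢s) (≡.sym (updateAt-updates s M))) t)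

  cofactor-expansion : ∀ {n} (N : Matrix (suc n) (suc n)) i → N i · cofactor N ≈ δ i zero * det N
  cofactor-expansion N zero    = sym (*-identityˡ _)
  cofactor-expansion N (suc i) =
    trans (det-alternating _ (N [ zero ]≔ N (suc i)) {zero} {suc i} (λ ()) (λ _ → refl)) (sym (zeroˡ _))

  det-pivot : ∀ {n} (M : Matrix (suc n) (suc n)) → (∀ i → M (suc i) zero ≈ 0#) →
    det M ≈ M zero zero * det (minor zero M)
  cofactor-pivot : ∀ {n} (M : Matrix (suc n) (suc n)) → (∀ i → M (suc i) zero ≈ 0#) →
    ∀ j → cofactor M (suc j) ≈ 0#
  det-firstColumnZero : ∀ {n} (M : Matrix (suc n) (suc n)) → (∀ i → M i zero ≈ 0#) → det M ≈ 0#

  det-pivot M col≈0 = begin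
    M zero zero * (1# * det (minor zero M)) + (M zero ∘ suc) · (cofactor M ∘ suc)
      ≈⟨ +-cong (*-congˡ (*-identityˡ _)) (·-zeroʳ (M zero ∘ suc) (cofactor-pivot M col≈0)) ⟩
    M zero zero * det (minor zero M) + 0#
      ≈⟨ +-identityʳ _ ⟩
    M zero zero * det (minor zero M)
      ∎

  cofactor-pivot {suc n} M col≈0 j =
    trans (*-congˡ (det-firstColumnZero (minor (suc j) M) col≈0)) (zeroʳ (sgn (suc j)))

  det-firstColumnZero M col≈0 = begin
    det M                             ≈⟨ det-pivot M (col≈0 ∘ suc) ⟩
    M zero zero * det (minor zero M)  ≈⟨ *-congʳ (col≈0 zero) ⟩
    0# * det (minor zero M)           ≈⟨ zeroˡ _ ⟩
    0#                                ∎

module Invertibility {c ℓ : Level} (F : Field c ℓ) where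
  open Field F hiding (zero)
  open FieldDefs F
  open Vectors F
  open Determinants F
  open import Algebra.Properties.Ring ring using (-‿distribˡ-*; -‿distribʳ-*)
  open import Algebra.Solver.Ring.NaturalCoefficients.Default commutativeSemiring
    using (solve; _:=_; _:+_; _:*_)
  open import Data.Fin using (toℕ; fromℕ<)
  open import Data.Fin.Properties using (_≟_; toℕ<n; toℕ-fromℕ<; toℕ-injective; suc-injective)
  open import Data.Fin.Permutation.Components using (transpose; transpose-inverse)
  open import Data.Nat.Properties using (≤-refl; <⇒≤; ≤∧≢⇒<)
  open import Data.Vec.Functional.Properties using (updateAt-updates; updateAt-minimal)
  open import Relation.Binary.Reasoning.Setoid setoid

  TrivialKernel : ∀ {m k} → Matrix m k → Set (c ⊔ ℓ)
  TrivialKernel M = ∀ w → (∀ i → (M *ᵥ w) i ≈ 0#) → ∀ j → w j ≈ 0#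

  trivialKernel-reindexRows : ∀ {m m′ k} (M : Matrix m k) (σ : Fin m′ → Fin m) (σ⁻ : Fin m → Fin m′) →
    σ ∘ σ⁻ ≗ id → TrivialKernel M → TrivialKernel (M ∘ σ)
  trivialKernel-reindexRows M σ σ⁻ σ∘σ⁻≗id ker w Mσw≈0 = ker w λ i →
    trans (reflexive (≡.cong (λ i′ → M i′ · w) (≡.sym (σ∘σ⁻≗id i)))) (Mσw≈0 (σ⁻ i))

  trivialKernel-addRow : ∀ {n k} (M : Matrix n k) {r s} a → r ≢ s → TrivialKernel M →
    TrivialKernel (M [ s ]≔ (λ t → M s t + a * M r t))
  trivialKernel-addRow M {r} {s} a r≢s ker w M′w≈0 = ker w Mw≈0
    where
    M′ = M [ s ]≔ (λ t → M s t + a * M r t)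
    unchanged : ∀ {i} → i ≢ s → M i · w ≈ 0#
    unchanged {i} i≢s = trans (reflexive (≡.cong (_· w) (≡.sym (updateAt-minimal i s M i≢s)))) (M′w≈0 i)
    Mw≈0 : ∀ i → M i · w ≈ 0#
    Mw≈0 i with i ≟ s
    ... | no i≢s    = unchanged i≢s
    ... | yes ≡.refl = begin
      M s · w                                   ≈⟨ +-identityʳ _ ⟨
      M s · w + 0#                              ≈⟨ +-congˡ (trans (*-congˡ (unchanged r≢s)) (zeroʳ a)) ⟨
      M s · w + a * (M r · w)                   ≈⟨ sumF-linear a (λ j → trans (distribʳ (w j) (M s j) (a * M r j))
                                                                       (+-congˡ (*-assoc a (M r j) (w j)))) ⟨
      (λ t → M s t + a * M r t) · w            ≡⟨ ≡.cong (_· w) (updateAt-updates s M) ⟨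
      M′ s · w                                  ≈⟨ M′w≈0 s ⟩
      0#                                        ∎

  trivialKernel-minor : ∀ {n} (M : Matrix (suc n) (suc n)) {q} → M zero zero * q ≈ 1# →
    (∀ i → M (suc i) zero ≈ 0#) → TrivialKernel M → TrivialKernel (minor zero M)
  trivialKernel-minor {n} M {q} pivot col₀≈0 ker w minor·w≈0 t = ker w′ Mw′≈0 (suc t)
    where
    S : Carrier
    S = (M zero ∘ suc) · w
    w′ : Fin (suc n) → Carrier
    w′ zero    = - (q * S)
    w′ (suc t) = w t
    Mw′≈0 : ∀ i → M i · w′ ≈ 0#
    Mw′≈0 zero = begin
      M zero zero * - (q * S) + S    ≈⟨ +-congʳ (-‿distribʳ-* _ _) ⟨
      - (M zero zero * (q * S)) + S  ≈⟨ +-congʳ (-‿cong (trans (sym (*-assoc (M zero zero) q S))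
                                                          (trans (*-congʳ pivot) (*-identityˡ S)))) ⟩
      - S + S                        ≈⟨ -‿inverseˡ S ⟩
      0#                             ∎
    Mw′≈0 (suc i) = trans (+-cong (trans (*-congʳ (col₀≈0 i)) (zeroˡ _)) (minor·w≈0 i)) (+-identityˡ 0#)

  x*y≈1⇒x*z≈0⇒z≈0 : ∀ {x y z} → x * y ≈ 1# → x * z ≈ 0# → z ≈ 0#
  x*y≈1⇒x*z≈0⇒z≈0 {x} {y} {z} xy≈1 xz≈0 = begin
    z            ≈⟨ *-identityˡ z ⟨
    1# * z       ≈⟨ *-congʳ xy≈1 ⟨
    x * y * z    ≈⟨ solve 3 (λ x y z → x :* y :* z := y :* (x :* z)) refl x y z ⟩
    y * (x * z)  ≈⟨ *-congˡ xz≈0 ⟩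
    y * 0#       ≈⟨ zeroʳ y ⟩
    0#           ∎

  DetNonzero : ℕ → Set (c ⊔ ℓ)
  DetNonzero n = ∀ (M : Matrix n n) → TrivialKernel M → ¬ det M ≈ 0#

  -- Gaussian elimination: clear the first column below the pivot, bottom row first, then recurse on the minor.
  det≉0-withPivot : ∀ {n} → DetNonzero n → (M : Matrix (suc n) (suc n)) {q : Carrier} →
    M zero zero * q ≈ 1# → TrivialKernel M → ¬ det M ≈ 0#
  det≉0-withPivot {n} det≉0-minor M {q} pivot ker =
    clearFrom n ≤-refl M pivot ker (λ r n≤r → ⊥-elim (<⇒≱ (toℕ<n r) n≤r))
    where
    clearFrom : ∀ t → t ≤ n → (N : Matrix (suc n) (suc n)) → N zero zero * q ≈ 1# → TrivialKernel N →
      (∀ r → t ≤ toℕ r → N (suc r) zero ≈ 0#) → ¬ det N ≈ 0#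
    clearFrom zero _ N pivot ker cleared det≈0 =
      det≉0-minor (minor zero N) (trivialKernel-minor N pivot col₀≈0 ker)
        (x*y≈1⇒x*z≈0⇒z≈0 pivot (trans (sym (det-pivot N col₀≈0)) det≈0))
      where
      col₀≈0 : ∀ i → N (suc i) zero ≈ 0#
      col₀≈0 i = cleared i ℕ.z≤n
    clearFrom (suc t) t<n N pivot ker cleared det≈0 =
      clearFrom t (<⇒≤ t<n) N′ pivot (trivialKernel-addRow N {zero} {suc r₀} a (λ ()) ker) cleared′
        (trans (det-addRow N {zero} {suc r₀} a (λ ())) det≈0)
      where
      r₀ : Fin n
      r₀ = fromℕ< t<n
      a : Carrier
      a = - (N (suc r₀) zero * q)
      N′ : Matrix (suc n) (suc n)
      N′ = N [ suc r₀ ]≔ (λ u → N (suc r₀) u + a * N zero u)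
      cleared′ : ∀ r → t ≤ toℕ r → N′ (suc r) zero ≈ 0#
      cleared′ r t≤r with r ≟ r₀
      ... | yes ≡.refl = begin
        N′ (suc r) zero                                         ≡⟨ ≡.cong-app (updateAt-updates (suc r) N) zero ⟩
        N (suc r) zero + - (N (suc r) zero * q) * N zero zero   ≈⟨ +-congˡ (-‿distribˡ-* _ _) ⟨
        N (suc r) zero + - (N (suc r) zero * q * N zero zero)   ≈⟨ +-congˡ (-‿cong eliminated) ⟩
        N (suc r) zero + - N (suc r) zero                       ≈⟨ -‿inverseʳ _ ⟩
        0#                                                      ∎
        where
        eliminated : N (suc r) zero * q * N zero zero ≈ N (suc r) zero
        eliminated = begin
          N (suc r) zero * q * N zero zero    ≈⟨ solve 3 (λ x q p → x :* q :* p := x :* (p :* q)) refl (N (suc r) zero) q (N zero zero) ⟩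
          N (suc r) zero * (N zero zero * q)  ≈⟨ *-congˡ pivot ⟩
          N (suc r) zero * 1#                 ≈⟨ *-identityʳ _ ⟩
          N (suc r) zero                      ∎
      ... | no r≢r₀ = trans (reflexive (≡.cong-app (updateAt-minimal (suc r) (suc r₀) N (r≢r₀ ∘ suc-injective)) zero))
                            (cleared r (≤∧≢⇒< t≤r t≢r))
        where
        t≢r : t ≢ toℕ r
        t≢r t≡r = r≢r₀ (toℕ-injective (≡.trans (≡.sym t≡r) (≡.sym (toℕ-fromℕ< t<n))))

  det≉0 : ∀ n → DetNonzero n
  det≉0 zero    M ker = 1≉0
  det≉0 (suc n) M ker det≈0 = ¬¬-∀ pivotAt firstColumnNonzero
    where
    firstColumnNonzero : ¬ (∀ i → M i zero ≈ 0#)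
    firstColumnNonzero col≈0 = 1≉0 (ker (δ zero) (λ i → trans (·-δ (M i) zero) (col≈0 i)) zero)
    pivotAt : ∀ i → ¬ ¬ M i zero ≈ 0#
    pivotAt zero M₀₀≉0 with inverse _ M₀₀≉0
    ... | q , pivot = det≉0-withPivot (det≉0 n) M pivot ker det≈0
    pivotAt (suc i) Mᵢ₀≉0 with inverse _ Mᵢ₀≉0
    ... | y , Mᵢ₀y≈1 = det≉0-withPivot (det≉0 n) M₁ pivot (trivialKernel-addRow M {suc i} {zero} a (λ ()) ker)
                         (trans (det-addRow M {suc i} {zero} a (λ ())) det≈0)
      where
      -- adding this multiple of row i + 1 to row 0 makes the corner entry 1
      a : Carrier
      a = (1# - M zero zero) * y
      M₁ : Matrix (suc n) (suc n)
      M₁ = M [ zero ]≔ (λ t → M zero t + a * M (suc i) t)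
      pivot : M₁ zero zero * 1# ≈ 1#
      pivot = begin
          (M zero zero + (1# - M zero zero) * y * M (suc i) zero) * 1#
        ≈⟨ *-identityʳ _ ⟩
          M zero zero + (1# - M zero zero) * y * M (suc i) zero
        ≈⟨ +-congˡ (trans (*-assoc _ y _) (*-congˡ (trans (*-comm y _) Mᵢ₀y≈1))) ⟩
          M zero zero + (1# - M zero zero) * 1#
        ≈⟨ +-congˡ (*-identityʳ _) ⟩
          M zero zero + (1# + - M zero zero)
        ≈⟨ solve 3 (λ x u n → x :+ (u :+ n) := u :+ (x :+ n)) refl (M zero zero) 1# (- M zero zero) ⟩
          1# + (M zero zero + - M zero zero)
        ≈⟨ +-congˡ (-‿inverseʳ _) ⟩
          1# + 0#
        ≈⟨ +-identityʳ 1# ⟩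
          1#
        ∎

  δ-transpose : ∀ {n} (l i : Fin (suc n)) → δ (transpose zero l i) zero ≡ δ i l
  δ-transpose l i with i ≟ zero
  ... | yes ≡.refl = δ-sym l zero
  ... | no i≢0 with i ≟ l
  ...   | yes ≡.refl = ≡.sym (δ-refl i)
  ...   | no i≢l     = ≡.trans (δ-≢ i≢0) (≡.sym (δ-≢ i≢l))

  -- Scaled by 1 / det N, the cofactors of N (M with rows 0 and l exchanged) solve M w = e_l.
  rightInverse : ∀ {n} (M : Matrix n n) → TrivialKernel M → ∀ l → ∃ λ w → ∀ i → M i · w ≈ δ i l
  rightInverse {suc n} M ker l = (λ j → e * cofactor N j) , λ i → begin
      M i · (λ j → e * cofactor N j)            ≈⟨ sumF-cong (λ j → solve 3 (λ m e c → m :* (e :* c) := e :* (m :* c))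
                                                                   refl (M i j) e (cofactor N j)) ⟩
      sumF (λ j → e * (M i j * cofactor N j))   ≈⟨ *-distribˡ-sumF e (λ j → M i j * cofactor N j) ⟨
      e * (M i · cofactor N)                    ≡⟨ ≡.cong (λ row → e * (row · cofactor N)) (N-τ i) ⟨
      e * (N (τ i) · cofactor N)                ≈⟨ *-congˡ (cofactor-expansion N (τ i)) ⟩
      e * (δ (τ i) zero * det N)                ≈⟨ solve 3 (λ e d D → e :* (d :* D) := d :* (D :* e)) refl e (δ (τ i) zero) (det N) ⟩
      δ (τ i) zero * (det N * e)                ≈⟨ *-cong (reflexive (δ-transpose l i)) detN*e≈1 ⟩
      δ i l * 1#                                ≈⟨ *-identityʳ _ ⟩
      δ i l                                     ∎
    where
    τ : Fin (suc n) → Fin (suc n)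
    τ = transpose zero l
    N : Matrix (suc n) (suc n)
    N = M ∘ transpose l zero
    N-τ : ∀ i → N (τ i) ≡ M i
    N-τ i = ≡.cong M (transpose-inverse l zero)
    ker-N : TrivialKernel N
    ker-N = trivialKernel-reindexRows M (transpose l zero) τ (λ _ → transpose-inverse l zero) ker
    e : Carrier
    e = proj₁ (inverse (det N) (det≉0 (suc n) N ker-N))
    detN*e≈1 : det N * e ≈ 1#
    detN*e≈1 = proj₂ (inverse (det N) (det≉0 (suc n) N ker-N))

  trivialKernel⇒surjective : ∀ {n} (M : Matrix n n) → TrivialKernel M → ∀ b → ∃ λ w → ∀ i → M i · w ≈ b i
  trivialKernel⇒surjective {n} M ker b = W ᵀ *ᵥ b , λ i → begin
      M i · (W ᵀ *ᵥ b)   ≈⟨ ·-comm (M i) (W ᵀ *ᵥ b) ⟩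
      (W ᵀ *ᵥ b) · M i   ≈⟨ ᵀ-adjoint W b (M i) ⟩
      b · (W *ᵥ M i)     ≈⟨ sumF-cong (λ l → *-congˡ (trans (·-comm (W l) (M i)) (proj₂ (rightInverse M ker l) i))) ⟩
      b · δ i            ≈⟨ ·-δ b i ⟩
      b i                ∎
    where
    W : Matrix n n
    W l = proj₁ (rightInverse M ker l)

  trivialKernel-ᵀ : ∀ {n} (M : Matrix n n) → TrivialKernel M → TrivialKernel (M ᵀ)
  trivialKernel-ᵀ {n} M ker y Mᵀy≈0 l = begin
      y l                ≈⟨ ·-δ y l ⟨
      y · δ l            ≈⟨ sumF-cong (λ i → *-congˡ (Mw≈δ i)) ⟨
      y · (M *ᵥ w)       ≈⟨ ᵀ-adjoint M y w ⟨
      (M ᵀ *ᵥ y) · w     ≈⟨ sumF-zero (λ j → trans (*-congʳ (Mᵀy≈0 j)) (zeroˡ (w j))) ⟩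
      0#                 ∎
    where
    w : Fin n → Carrier
    w = proj₁ (trivialKernel⇒surjective M ker (δ l))
    Mw≈δ : ∀ i → M i · w ≈ δ l i
    Mw≈δ = proj₂ (trivialKernel⇒surjective M ker (δ l))

module Enumerations {c ℓ : Level} (F : Field c ℓ) where
  open Field F hiding (zero)
  open FieldDefs F

  record Enumeration {k} (U : Subset k) (m : ℕ) : Set (c ⊔ ℓ) where
    field
      index            : Fin m → Fin k
      index∈           : ∀ l → index l ∈ U
      index-surjective : ∀ {j} → j ∈ U → ∃ λ l → index l ≡ j
      sumF-index       : ∀ f → (∀ {j} → j ∉ U → f j ≈ 0#) → sumF f ≈ sumF (f ∘ index)
      extend           : (Fin m → Carrier) → Fin k → Carrier
      extend-index     : ∀ w l → extend w (index l) ≈ w l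
      extend-∉         : ∀ w {j} → j ∉ U → extend w j ≈ 0#

  private
    index : ∀ {k} (U : Subset k) → Fin ∣ U ∣ → Fin k
    index (inside  ∷ U) zero    = zero
    index (inside  ∷ U) (suc l) = suc (index U l)
    index (outside ∷ U) l       = suc (index U l)

    index∈ : ∀ {k} (U : Subset k) l → index U l ∈ U
    index∈ (inside  ∷ U) zero    = here
    index∈ (inside  ∷ U) (suc l) = there (index∈ U l)
    index∈ (outside ∷ U) l       = there (index∈ U l)

    index-surjective : ∀ {k} (U : Subset k) {j} → j ∈ U → ∃ λ l → index U l ≡ j
    index-surjective (inside  ∷ U) here = zero , ≡.refl
    index-surjective (inside  ∷ U) (there j∈U) with index-surjective U j∈U
    ... | l , ≡.refl = suc l , ≡.refl
    index-surjective (outside ∷ U) (there j∈U) with index-surjective U j∈U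
    ... | l , ≡.refl = l , ≡.refl

    sumF-index : ∀ {k} (U : Subset k) f → (∀ {j} → j ∉ U → f j ≈ 0#) → sumF f ≈ sumF (f ∘ index U)
    sumF-index []            f f≈0 = refl
    sumF-index (inside  ∷ U) f f≈0 = +-congˡ (sumF-index U (f ∘ suc) (λ j∉U → f≈0 (j∉U ∘ drop-there)))
    sumF-index (outside ∷ U) f f≈0 =
      trans (+-cong (f≈0 λ ()) (sumF-index U (f ∘ suc) (λ j∉U → f≈0 (j∉U ∘ drop-there)))) (+-identityˡ _)

    extend : ∀ {k} (U : Subset k) → (Fin ∣ U ∣ → Carrier) → Fin k → Carrier
    extend (inside  ∷ U) w zero    = w zero
    extend (inside  ∷ U) w (suc j) = extend U (w ∘ suc) j
    extend (outside ∷ U) w zero    = 0#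
    extend (outside ∷ U) w (suc j) = extend U w j

    extend-index : ∀ {k} (U : Subset k) w l → extend U w (index U l) ≡ w l
    extend-index (inside  ∷ U) w zero    = ≡.refl
    extend-index (inside  ∷ U) w (suc l) = extend-index U (w ∘ suc) l
    extend-index (outside ∷ U) w l       = extend-index U w l

    extend-∉ : ∀ {k} (U : Subset k) w {j} → j ∉ U → extend U w j ≡ 0#
    extend-∉ (inside  ∷ U) w {zero}  j∉U = ⊥-elim (j∉U here)
    extend-∉ (inside  ∷ U) w {suc j} j∉U = extend-∉ U (w ∘ suc) (j∉U ∘ there)
    extend-∉ (outside ∷ U) w {zero}  j∉U = ≡.refl
    extend-∉ (outside ∷ U) w {suc j} j∉U = extend-∉ U w (j∉U ∘ there)

  enumeration : ∀ {k m} (U : Subset k) → ∣ U ∣ ≡ m → Enumeration U m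
  enumeration U ≡.refl = record
    { index            = index U
    ; index∈           = index∈ U
    ; index-surjective = index-surjective U
    ; sumF-index       = sumF-index U
    ; extend           = extend U
    ; extend-index     = λ w l → reflexive (extend-index U w l)
    ; extend-∉         = λ w j∉U → reflexive (extend-∉ U w j∉U)
    }

module AffineDependencies {c ℓ : Level} (F : Field c ℓ) {m k n} (A : FieldDefs.Matrix F m k)
  (x : Fin k → Fin n → Field.Carrier F) (balanced : FieldDefs.RowBalanced F A)
  (solution : FieldDefs.IsSolution F A x) where
  open Field F hiding (zero)
  open FieldDefs F
  open Vectors F
  open Invertibility F
  open Enumerations F
  open Enumeration
  open import Algebra.Properties.Ring ring using (x≈y⇒x∙y⁻¹≈ε; x∙y⁻¹≈ε⇒x≈y)
  open import Relation.Binary.Reasoning.Setoid setoid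

  submatrix : ∀ {U} → Enumeration U m → Matrix m m
  submatrix E i l = A i (index E l)

  linIndepOn⇒trivialKernel : ∀ {U} (E : Enumeration U m) → LinIndepOn (col A) U → TrivialKernel (submatrix E)
  linIndepOn⇒trivialKernel E indep w Ew≈0 l = begin
      w l                      ≈⟨ extend-index E w l ⟨
      extend E w (index E l)   ≈⟨ indep (extend E w) (λ _ → extend-∉ E w) annihilated (index E l) (index∈ E l) ⟩
      0#                       ∎
    where
    annihilated : ∀ t → extend E w · A t ≈ 0#
    annihilated t = begin
        extend E w · A t
      ≈⟨ sumF-index E _ (λ j∉U → trans (*-congʳ (extend-∉ E w j∉U)) (zeroˡ _)) ⟩
        sumF (λ l → extend E w (index E l) * A t (index E l))
      ≈⟨ sumF-cong (λ l → trans (*-congʳ (extend-index E w l)) (*-comm (w l) _)) ⟩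
        submatrix E t · w
      ≈⟨ Ew≈0 t ⟩
        0#
      ∎

  trivialKernel⇒linIndepOn : ∀ {U} (E : Enumeration U m) → TrivialKernel (submatrix E) → LinIndepOn (col A) U
  trivialKernel⇒linIndepOn E ker a a∉≈0 Aa≈0 j j∈U with index-surjective E j∈U
  ... | l , ≡.refl = ker (a ∘ index E) (λ t → trans (sym (reindexed t)) (Aa≈0 t)) l
    where
    reindexed : ∀ t → a · A t ≈ submatrix E t · (a ∘ index E)
    reindexed t = trans (sumF-index E _ λ {j} j∉U → trans (*-congʳ (a∉≈0 j j∉U)) (zeroˡ _))
                        (sumF-cong (λ l → *-comm (a (index E l)) _))

  trivialKernel-Aᵀ : ∀ {U} (E : Enumeration U m) → TrivialKernel (submatrix E) → TrivialKernel (A ᵀ)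
  trivialKernel-Aᵀ E ker y Aᵀy≈0 = trivialKernel-ᵀ (submatrix E) ker y (Aᵀy≈0 ∘ index E)

  AffineDependency : (Fin k → Carrier) → Set ℓ
  AffineDependency a = sumF a ≈ 0# × ∀ t → a · (λ j → x j t) ≈ 0#

  rowCombination-affineDependency : ∀ y → AffineDependency (A ᵀ *ᵥ y)
  rowCombination-affineDependency y = sum≈0 , λ t →
    trans (ᵀ-adjoint A y (λ j → x j t)) (·-zeroʳ y (λ i → solution i t))
    where
    sum≈0 : sumF (A ᵀ *ᵥ y) ≈ 0#
    sum≈0 = begin
      sumF (A ᵀ *ᵥ y)             ≈⟨ ·-1ʳ (A ᵀ *ᵥ y) ⟨
      (A ᵀ *ᵥ y) · (λ _ → 1#)     ≈⟨ ᵀ-adjoint A y (λ _ → 1#) ⟩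
      y · (A *ᵥ (λ _ → 1#))       ≈⟨ ·-zeroʳ y (λ i → trans (·-1ʳ (A i)) (balanced i)) ⟩
      0#                          ∎

  affineDependency-− : ∀ {a b} → AffineDependency a → AffineDependency b → AffineDependency (λ j → a j - b j)
  affineDependency-− {a} {b} (∑a≈0 , a·x≈0) (∑b≈0 , b·x≈0) =
    trans (sumF-− a b) (x≈y⇒x∙y⁻¹≈ε (trans ∑a≈0 (sym ∑b≈0))) , λ t →
    trans (·-−ˡ a b (λ j → x j t)) (x≈y⇒x∙y⁻¹≈ε (trans (a·x≈0 t) (sym (b·x≈0 t))))

  affIndepOn-⊆ : ∀ {W′ W} → W′ ⊆ W → AffIndepOn x W → AffIndepOn x W′
  affIndepOn-⊆ W′⊆W indep a a∉≈0 ∑a≈0 a·x≈0 j j∈W′ =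
    indep a (λ j j∉W → a∉≈0 j (j∉W ∘ W′⊆W)) ∑a≈0 a·x≈0 j (W′⊆W j∈W′)

  module _ (rowsIndependent : TrivialKernel (A ᵀ)) where

    -- A row combination vanishing on V is an affine dependency supported on ∁ V, hence zero.
    trivialKernel-submatrix : ∀ {V} (E : Enumeration V m) → AffIndepOn x (∁ V) → TrivialKernel (submatrix E)
    trivialKernel-submatrix {V} E indep = trivialKernel-ᵀ (submatrix E ᵀ) kerᵀ
      where
      kerᵀ : TrivialKernel (submatrix E ᵀ)
      kerᵀ y Eᵀy≈0 = rowsIndependent y vanishes
        where
        onV : ∀ {j} → j ∈ V → (A ᵀ *ᵥ y) j ≈ 0#
        onV j∈V with index-surjective E j∈V
        ... | l , ≡.refl = Eᵀy≈0 l
        vanishes : ∀ j → (A ᵀ *ᵥ y) j ≈ 0#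
        vanishes j with j ∈? V
        ... | yes j∈V = onV j∈V
        ... | no  j∉V = indep (A ᵀ *ᵥ y) (λ _ j∉∁V → onV (x∉∁p⇒x∈p j∉∁V))
          (proj₁ (rowCombination-affineDependency y)) (proj₂ (rowCombination-affineDependency y)) j (x∉p⇒x∈∁p j∉V)

    affineDependency-unique : ∀ {S} → AffIndepOn x S → ∀ {a} → AffineDependency a →
      ∀ y → (∀ j → j ∉ S → a j ≈ (A ᵀ *ᵥ y) j) → ∀ j → a j ≈ (A ᵀ *ᵥ y) j
    affineDependency-unique {S} indep {a} dep y agree j = x∙y⁻¹≈ε⇒x≈y (a j) ((A ᵀ *ᵥ y) j) (d≈0 j)
      where
      d : Fin k → Carrier
      d j = a j - (A ᵀ *ᵥ y) j
      d-∉ : ∀ j → j ∉ S → d j ≈ 0#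
      d-∉ j j∉S = x≈y⇒x∙y⁻¹≈ε (agree j j∉S)
      d-dep : AffineDependency d
      d-dep = affineDependency-− dep (rowCombination-affineDependency y)
      d≈0 : ∀ j → d j ≈ 0#
      d≈0 j with j ∈? S
      ... | yes j∈S = indep d d-∉ (proj₁ d-dep) (proj₂ d-dep) j j∈S
      ... | no  j∉S = d-∉ j j∉S

    affineDependency⇒rowCombination : ∀ {S} → AffIndepOn x S → Enumeration (∁ S) m →
      ∀ {a} → AffineDependency a → ∃ λ y → ∀ j → a j ≈ (A ᵀ *ᵥ y) j
    affineDependency⇒rowCombination {S} indep E {a} dep =
      fromSurjection (trivialKernel⇒surjective (submatrix E ᵀ) kerᵀ (a ∘ index E))
      where
      ∁∁S⊆S : ∁ (∁ S) ⊆ S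
      ∁∁S⊆S j∈∁∁S = x∉∁p⇒x∈p (x∈∁p⇒x∉p j∈∁∁S)
      kerᵀ : TrivialKernel (submatrix E ᵀ)
      kerᵀ = trivialKernel-ᵀ (submatrix E) (trivialKernel-submatrix E (affIndepOn-⊆ ∁∁S⊆S indep))
      fromSurjection : (∃ λ y → ∀ l → (submatrix E ᵀ) l · y ≈ a (index E l)) →
        ∃ λ y → ∀ j → a j ≈ (A ᵀ *ᵥ y) j
      fromSurjection (y , Eᵀy≈a) = y , affineDependency-unique indep dep y agree
        where
        agree : ∀ j → j ∉ S → a j ≈ (A ᵀ *ᵥ y) j
        agree j j∉S with index-surjective E (x∉p⇒x∈∁p j∉S)
        ... | l , ≡.refl = sym (Eᵀy≈a l)

    affIndepOn-∁ : ∀ {U S} (E : Enumeration U m) → TrivialKernel (submatrix E) →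
      AffIndepOn x S → Enumeration (∁ S) m → AffIndepOn x (∁ U)
    affIndepOn-∁ {U} E ker indep E′ a a∉≈0 ∑a≈0 a·x≈0 j j∈∁U =
      trans (a≈Aᵀy j) (·-zeroʳ (col A j) y≈0)
      where
      rowCombination : ∃ λ y → ∀ j → a j ≈ (A ᵀ *ᵥ y) j
      rowCombination = affineDependency⇒rowCombination indep E′ (∑a≈0 , a·x≈0)
      y : Fin m → Carrier
      y = proj₁ rowCombination
      a≈Aᵀy : ∀ j → a j ≈ (A ᵀ *ᵥ y) j
      a≈Aᵀy = proj₂ rowCombination
      y≈0 : ∀ i → y i ≈ 0#
      y≈0 = trivialKernel-ᵀ (submatrix E) ker y λ l →
        trans (sym (a≈Aᵀy (index E l))) (a∉≈0 _ (x∈p⇒x∉∁p (index∈ E l)))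

lemma2p9 : ∀ {c ℓ : Level} (F : Field c ℓ) (m k n : ℕ)
    (A : FieldDefs.Matrix F m k) (x : Fin k → Fin n → Field.Carrier F) →
    FieldDefs.RowBalanced F A → FieldDefs.HasRank F A m →
    FieldDefs.IsSolution F A x → FieldDefs.ARankOn F x ⊤ (k ∸ m) →
    (U : Subset k) → ∣ U ∣ ≡ m →
    FieldDefs.IsBasis F A U ⇔ FieldDefs.ARankOn F x (∁ U) (k ∸ m)
lemma2p9 F m k n A x balanced hasRank@((S₀ , _ , indep₀ , ∣S₀∣≡m) , _) solution
         ((S₁ , _ , indep₁ , ∣S₁∣≡k∸m) , _) U ∣U∣≡m = mk⇔ basis⇒aRank aRank⇒basis
  where
  open FieldDefs F
  open Vectors F using (_ᵀ)
  open Invertibility F using (TrivialKernel)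
  open Enumerations F using (Enumeration; enumeration)
  open AffineDependencies F A x balanced solution

  rowsIndependent : TrivialKernel (A ᵀ)
  rowsIndependent = trivialKernel-Aᵀ E₀ (linIndepOn⇒trivialKernel E₀ indep₀)
    where
    E₀ : Enumeration S₀ m
    E₀ = enumeration S₀ ∣S₀∣≡m

  ∣∁S₁∣≡m : ∣ ∁ S₁ ∣ ≡ m
  ∣∁S₁∣≡m = ≡.trans (∣∁p∣≡n∸∣p∣ S₁) (≡.trans (≡.cong (k ∸_) ∣S₁∣≡k∸m)
              (m∸[m∸n]≡n (≡.subst (_≤ k) ∣S₀∣≡m (∣p∣≤n S₀))))

  ∣∁U∣≡k∸m : ∣ ∁ U ∣ ≡ k ∸ m
  ∣∁U∣≡k∸m = ≡.trans (∣∁p∣≡n∸∣p∣ U) (≡.cong (k ∸_) ∣U∣≡m)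

  EU : Enumeration U m
  EU = enumeration U ∣U∣≡m

  E₁ : Enumeration (∁ S₁) m
  E₁ = enumeration (∁ S₁) ∣∁S₁∣≡m

  basis⇒aRank : IsBasis A U → ARankOn x (∁ U) (k ∸ m)
  basis⇒aRank (indepU , _) =
    (∁ U , id , affIndepOn-∁ rowsIndependent EU (linIndepOn⇒trivialKernel EU indepU) indep₁ E₁ , ∣∁U∣≡k∸m) ,
    λ S S⊆∁U _ → ≡.subst (∣ S ∣ ≤_) ∣∁U∣≡k∸m (p⊆q⇒∣p∣≤∣q∣ S⊆∁U)

  aRank⇒basis : ARankOn x (∁ U) (k ∸ m) → IsBasis A U
  aRank⇒basis ((S , S⊆∁U , indepS , ∣S∣≡k∸m) , _) =
    trivialKernel⇒linIndepOn EU (trivialKernel-submatrix rowsIndependent EU (affIndepOn-⊆ ∁U⊆S indepS)) ,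
    ≡.subst (HasRank A) (≡.sym ∣U∣≡m) hasRank
    where
    ∁U⊆S : ∁ U ⊆ S
    ∁U⊆S = p⊆q⇒∣q∣≤∣p∣⇒q⊆p S⊆∁U (≤-reflexive (≡.trans ∣∁U∣≡k∸m (≡.sym ∣S∣≡k∸m)))
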